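{- Let $g\ge4$ be even. If $m$ is a primitive number (with respect to $g$), then $\gcd(m,g)=1$.
   Context: For an odd integer $m\ge1$, an extreme cycle for the digit set $\{0,m\}$ (with respect to $g$) is a finite set of distinct integers $\{x_0,\dots,x_{r-1}\}$ together with digits $l_0,\dots,l_{r-1}\in\{0,m\}$ such that $x_{j+1}=(x_j+l_j)/g$ for $0\le j\le r-2$ and $x_0=(x_{r-1}+l_{r-1})/g$. The cycle $\{0\}$ is the trivial extreme cycle. $m$ is complete if the only extreme cycle for $\{0,m\}$ is the trivial one, and incomplete otherwise. An odd number $m$ is primitive if it is incomplete and every proper divisor of $m$ is complete. -}

module Defs where

open import Data.Nat using (ℕ; zero; suc; _≤_)
open import Data.Nat.DivMod using (_mod_)
open import Data.Nat.Divisibility using (_∣_)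
open import Data.Fin using (Fin; toℕ)
open import Data.Integer using (ℤ; +_; _+_; _*_)
open import Data.Product using (Σ; _×_; ∃)
open import Data.Sum using (_⊎_)
open import Function.Definitions using (Injective)
open import Relation.Binary.PropositionalEquality using (_≡_)
open import Relation.Nullary using (¬_)

next : ∀ {n} → Fin (suc n) → Fin (suc n)
next {n} i = suc (toℕ i) mod (suc n)

-- An extreme cycle for the digit set {0,m} w.r.t. g, of length r = suc n:
-- distinct integers x_0..x_n and digits l_j ∈ {0,m} with
-- g * x_{j+1 mod r} = x_j + l_j  (i.e. x_{j+1} = (x_j + l_j)/g exactly).
record ExtremeCycle (g m : ℕ) : Set where
  field
    n        : ℕ
    x        : Fin (suc n) → ℤ
    l        : Fin (suc n) → ℤ
    distinct : Injective _≡_ _≡_ x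
    digit    : ∀ j → (l j ≡ + 0) ⊎ (l j ≡ + m)
    step     : ∀ j → + g * x (next j) ≡ x j + l j

Trivial : ∀ {g m} → ExtremeCycle g m → Set
Trivial c = ∀ j → ExtremeCycle.x c j ≡ + 0

Complete : ℕ → ℕ → Set
Complete g m = (c : ExtremeCycle g m) → Trivial c

Incomplete : ℕ → ℕ → Set
Incomplete g m = ¬ Complete g m

Odd : ℕ → Set
Odd m = ¬ (2 ∣ m)

Primitive : ℕ → ℕ → Set
Primitive g m = Odd m × Incomplete g m × (∀ d → d ∣ m → ¬ (d ≡ m) → Complete g d)

-- If d divides both g and m, every element of an extreme cycle for {0, m} is
-- divisible by d: x_j = g x_{j+1} − l_j and d divides g and l_j.  Dividing the
-- cycle by d gives an extreme cycle for {0, m/d}, which is trivial when m/d is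
-- complete.  Hence m = (m/d)·d is complete as well, so for primitive m the only
-- common divisor of m and g is 1.
module Submission where

open import Defs
open import Data.Nat as ℕ using (ℕ; _≤_; NonZero; ≢-nonZero; _≟_)
import Data.Nat.Properties as ℕₚ
open import Data.Nat.Divisibility using (_∣_; divides; quotient; quotient-∣; m∣n⇒n≡quotient*m)
open import Data.Nat.GCD using (gcd; gcd[m,n]∣m; gcd[m,n]∣n; gcd[m,n]≢0)
open import Data.Integer using (ℤ; +_; _+_; _*_; _-_)
import Data.Integer.Properties as ℤ
open import Data.Integer.Tactic.RingSolver using (solve-∀)
open import Data.Fin using (Fin)
open import Data.Sum using (_⊎_; inj₁; inj₂)
open import Data.Product using (Σ-syntax; _×_; _,_; proj₁; proj₂)
open import Relation.Nullary using (yes; no; contradiction)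
open import Relation.Binary.PropositionalEquality
  using (_≡_; _≢_; refl; sym; trans; cong; cong₂; subst; module ≡-Reasoning)

Digit : ℕ → ℤ → Set
Digit m z = (z ≡ + 0) ⊎ (z ≡ + m)

digit-÷ : ∀ {b d z} → Digit (b ℕ.* d) z → Σ[ z′ ∈ ℤ ] Digit b z′ × z ≡ z′ * + d
digit-÷           (inj₁ refl) = + 0 , inj₁ refl , refl
digit-÷ {b} {d}   (inj₂ refl) = + b , inj₂ refl , ℤ.pos-* b d

factor-step : ∀ a d u v w → a * d * u ≡ v + w * d → v ≡ (a * u - w) * d
factor-step a d u v w eq = begin
  v                  ≡⟨ add-sub v (w * d) ⟩
  v + w * d - w * d  ≡⟨ cong (_- w * d) eq ⟨
  a * d * u - w * d  ≡⟨ factor a d u w ⟩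
  (a * u - w) * d    ∎
  where
  open ≡-Reasoning
  add-sub : ∀ v e → v ≡ v + e - e
  add-sub = solve-∀
  factor : ∀ a d u w → a * d * u - w * d ≡ (a * u - w) * d
  factor = solve-∀

module DivideCycle {g b d : ℕ} .{{_ : NonZero d}} (d∣g : d ∣ g)
                   (c : ExtremeCycle g (b ℕ.* d)) where
  open ExtremeCycle c
  open ≡-Reasoning

  a : ℕ
  a = quotient d∣g

  g≡a*d : + g ≡ + a * + d
  g≡a*d = trans (cong +_ (m∣n⇒n≡quotient*m d∣g)) (ℤ.pos-* a d)

  divided-digit : ∀ j → Σ[ z ∈ ℤ ] Digit b z × l j ≡ z * + d
  divided-digit j = digit-÷ {b} {d} (digit j)

  l′ : Fin (ℕ.suc n) → ℤ
  l′ j = proj₁ (divided-digit j)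

  l≡l′*d : ∀ j → l j ≡ l′ j * + d
  l≡l′*d j = proj₂ (proj₂ (divided-digit j))

  y : Fin (ℕ.suc n) → ℤ
  y j = + a * x (next j) - l′ j

  x≡y*d : ∀ j → x j ≡ y j * + d
  x≡y*d j = factor-step (+ a) (+ d) (x (next j)) (x j) (l′ j) (begin
    + a * + d * x (next j)  ≡⟨ cong (_* x (next j)) g≡a*d ⟨
    + g * x (next j)        ≡⟨ step j ⟩
    x j + l j               ≡⟨ cong (λ t → x j + t) (l≡l′*d j) ⟩
    x j + l′ j * + d        ∎)

  y-step : ∀ j → + g * y (next j) ≡ y j + l′ j
  y-step j = ℤ.*-cancelʳ-≡ _ _ (+ d) (begin
    + g * y (next j) * + d    ≡⟨ ℤ.*-assoc (+ g) (y (next j)) (+ d) ⟩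
    + g * (y (next j) * + d)  ≡⟨ cong (+ g *_) (x≡y*d (next j)) ⟨
    + g * x (next j)          ≡⟨ step j ⟩
    x j + l j                 ≡⟨ cong₂ _+_ (x≡y*d j) (l≡l′*d j) ⟩
    y j * + d + l′ j * + d    ≡⟨ ℤ.*-distribʳ-+ (+ d) (y j) (l′ j) ⟨
    (y j + l′ j) * + d        ∎)

  y-injective : ∀ {i j} → y i ≡ y j → i ≡ j
  y-injective {i} {j} yi≡yj = distinct (begin
    x i        ≡⟨ x≡y*d i ⟩
    y i * + d  ≡⟨ cong (_* + d) yi≡yj ⟩
    y j * + d  ≡⟨ x≡y*d j ⟨
    x j        ∎)

  cycle : ExtremeCycle g b
  cycle = record
    { n        = n
    ; x        = y
    ; l        = l′
    ; distinct = y-injective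
    ; digit    = λ j → proj₁ (proj₂ (divided-digit j))
    ; step     = y-step
    }

complete-* : ∀ {g b d} .{{_ : NonZero d}} → d ∣ g → Complete g b → Complete g (b ℕ.* d)
complete-* {b = b} {d} d∣g complete c j = begin
  x j        ≡⟨ x≡y*d j ⟩
  y j * + d  ≡⟨ cong (_* + d) (complete cycle j) ⟩
  + 0        ∎
  where
  open ExtremeCycle c using (x)
  open DivideCycle {b = b} d∣g c
  open ≡-Reasoning

quotient-≢ : ∀ {d m} (d∣m : d ∣ m) .{{_ : NonZero m}} → d ≢ 1 → quotient d∣m ≢ m
quotient-≢ {d} {m} d∣m d≢1 q≡m = d≢1 (ℕₚ.*-cancelˡ-≡ d 1 m (begin
  m ℕ.* d             ≡⟨ cong (ℕ._* d) q≡m ⟨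
  quotient d∣m ℕ.* d  ≡⟨ m∣n⇒n≡quotient*m d∣m ⟨
  m                   ≡⟨ ℕₚ.*-identityʳ m ⟨
  m ℕ.* 1             ∎))
  where open ≡-Reasoning

lemma2p8 : (g m : ℕ) → 4 ≤ g → 2 ∣ g → Primitive g m → gcd m g ≡ 1
lemma2p8 g m 4≤g _ (odd , incomplete , divisors-complete) with gcd m g ≟ 1
... | yes gcd≡1 = gcd≡1
... | no gcd≢1 = contradiction (subst (Complete g) (sym m≡b*d) m-complete) incomplete
  where
  d∣m : gcd m g ∣ m
  d∣m = gcd[m,n]∣m m g

  b : ℕ
  b = quotient d∣m

  m≡b*d : m ≡ b ℕ.* gcd m g
  m≡b*d = m∣n⇒n≡quotient*m d∣m

  instance
    g≢0 : NonZero g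
    g≢0 = ℕ.>-nonZero (ℕₚ.<-≤-trans (ℕ.s≤s ℕ.z≤n) 4≤g)
    m≢0 : NonZero m
    m≢0 = ≢-nonZero λ { refl → odd (divides 0 refl) }
    d≢0 : NonZero (gcd m g)
    d≢0 = ≢-nonZero (gcd[m,n]≢0 m g (inj₂ (ℕ.≢-nonZero⁻¹ g)))

  m-complete : Complete g (b ℕ.* gcd m g)
  m-complete = complete-* (gcd[m,n]∣n m g)
                 (divisors-complete b (quotient-∣ d∣m) (quotient-≢ d∣m gcd≢1))
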